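{- Let $W$ be the polyomino consisting of the 17 tiles with centers $(0,2),(1,2),(2,2),(2,0),(2,1),(2,3),(2,4),(3,1),(3,3),(4,0),(4,1),(4,3),(4,4),(5,1),(5,3),(6,1),(6,3)$, and let $A=(0,2)$, $B=(6,3)$, $C=(6,1)$. Then: $W$ cannot be guarded by two queens; $W$ can be guarded by three queens one of which is on $A$; $W$ can be guarded by three queens two of which are on $B$ and $C$; and $W$ cannot be guarded by three queens two of which are on $A$ and $B$, nor by three queens two of which are on $A$ and $C$.
   Context: Tiles are unit squares identified with their centers in $\mathbb{Z}^2$. A queen on tile $p$ of a polyomino $P$ guards $p$ and, for each nonzero $v\in\{ -1,0,1\}^2$, every $p+kv$ ($k\ge1$) such that $p+jv$ is a tile of $P$ for all $0\le j\le k$. A set of queens guards $P$ if every tile of $P$ is guarded by some queen. -}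

module Defs where

open import Data.Integer using (ℤ; +_; -[1+_]; _+_; _*_)
open import Data.Nat using (ℕ; suc; _≤_)
open import Data.Product using (_×_; _,_; Σ; ∃)
open import Data.Sum using (_⊎_)
open import Data.List using (List; []; _∷_; length)
open import Data.List.Membership.Propositional using (_∈_)
open import Data.List.Relation.Unary.All using (All)
open import Data.List.Relation.Unary.Unique.Propositional using (Unique)
open import Relation.Binary.PropositionalEquality using (_≡_)

-- A tile is identified with its center in ℤ².
Tile : Set
Tile = ℤ × ℤ

Polyomino : Set
Polyomino = List Tile

_∈P_ : Tile → Polyomino → Set
p ∈P P = p ∈ P

m1 : ℤ
m1 = -[1+ 0 ]

directions : List Tile
directions =
  (+ 1 , + 0) ∷ (m1 , + 0) ∷ (+ 0 , + 1) ∷ (+ 0 , m1) ∷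
  (+ 1 , + 1) ∷ (+ 1 , m1) ∷ (m1 , + 1) ∷ (m1 , m1) ∷ []

step : Tile → ℕ → Tile → Tile
step (x , y) k (a , b) = (x + (+ k) * a , y + (+ k) * b)

Guards : Polyomino → Tile → Tile → Set
Guards P q t =
  t ≡ q ⊎
  Σ Tile (λ v → v ∈ directions × Σ ℕ (λ k →
     1 ≤ k × t ≡ step q k v × ((j : ℕ) → j ≤ k → step q j v ∈P P)))

IsQueenSet : Polyomino → List Tile → Set
IsQueenSet P Qs = Unique Qs × All (λ q → q ∈P P) Qs

GuardsAll : Polyomino → List Tile → Set
GuardsAll P Qs = All (λ t → Σ Tile (λ q → q ∈ Qs × Guards P q t)) P

GuardableWith : Polyomino → ℕ → List Tile → Set
GuardableWith P k Req =
  Σ (List Tile) (λ Qs → IsQueenSet P Qs × length Qs ≡ k ×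
     All (λ r → r ∈ Qs) Req × GuardsAll P Qs)

pt : ℕ → ℕ → Tile
pt x y = (+ x , + y)

W : Polyomino
W = pt 0 2 ∷ pt 1 2 ∷ pt 2 2 ∷ pt 2 0 ∷ pt 2 1 ∷ pt 2 3 ∷ pt 2 4 ∷
    pt 3 1 ∷ pt 3 3 ∷ pt 4 0 ∷ pt 4 1 ∷ pt 4 3 ∷ pt 4 4 ∷
    pt 5 1 ∷ pt 5 3 ∷ pt 6 1 ∷ pt 6 3 ∷ []

A B C : Tile
A = pt 0 2
B = pt 6 3
C = pt 6 1

-- A queen on q can only guard t along the direction v at the Chebyshev
-- distance k = d∞(q, t), so whether q guards t is decided by checking, for
-- each of the eight directions, the single candidate step k. This makes
-- guarding decidable for every polyomino, and the claims about W become
-- finite computations: two queens are ruled out by running over all pairs of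
-- tiles, and three queens with two prescribed ones by running over the third
-- queen, after permuting the prescribed queens to the front of the list.
module Submission where

open import Defs
open import Data.Fin using (Fin; toℕ; fromℕ<)
open import Data.Fin.Properties using (toℕ<n; toℕ-fromℕ<)
import Data.Fin.Properties as Fin
import Data.Integer as ℤ
open import Data.Integer using (+_; ∣_∣) renaming (_≟_ to _≟ℤ_)
open import Data.Integer.Properties using (abs-*; +-0-abelianGroup)
open import Algebra.Properties.AbelianGroup +-0-abelianGroup using (xyx⁻¹≈y)
open import Data.List using (List; []; _∷_; _++_; length)
open import Data.List.Membership.Propositional using (_∈_; find; lose)
open import Data.List.Membership.Propositional.Properties using (∈-∃++)
open import Data.List.Properties using (length-++)
open import Data.List.Relation.Binary.Permutation.Propositional using (_↭_; prep; ↭-refl; ↭-trans)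
open import Data.List.Relation.Binary.Permutation.Propositional.Properties using (shift; ∈-resp-↭; All-resp-↭; ↭-length)
open import Data.List.Relation.Unary.All as All using (All; []; _∷_; all?)
open import Data.List.Relation.Unary.All.Properties using (++⁻ʳ)
open import Data.List.Relation.Unary.Any using (Any; here; there; any?)
open import Data.List.Relation.Unary.Unique.Propositional using (Unique; []; _∷_)
open import Data.Nat using (ℕ; _+_; _*_; _≤_; _⊔_; s≤s; s≤s⁻¹; _≤?_)
open import Data.Nat.Properties using (*-distribˡ-⊔; *-identityʳ; +-cancelˡ-≡)
open import Data.Product using (_×_; _,_; ∃-syntax)
import Data.Product.Properties as Product
open import Data.Sum using (_⊎_; inj₁; inj₂)
open import Function using (_⇔_; mk⇔)
import Function.Properties.Equivalence as ⇔
open import Relation.Binary using (DecidableEquality)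
open import Relation.Binary.PropositionalEquality using (_≡_; _≢_; refl; sym; trans; cong; cong₂; subst; module ≡-Reasoning)
open import Relation.Nullary using (Dec; ¬_; ¬?; contradiction)
open import Relation.Nullary.Decidable using (_×-dec_; _⊎-dec_; True; toWitness; from-yes)
import Relation.Nullary.Decidable as Dec

_≟ᵗ_ : DecidableEquality Tile
_≟ᵗ_ = Product.≡-dec _≟ℤ_ _≟ℤ_

open import Data.List.Membership.DecPropositional _≟ᵗ_ using (_∈?_)
open import Data.List.Relation.Unary.Unique.DecPropositional _≟ᵗ_ using (unique?)

Ray : Polyomino → Tile → Tile → ℕ → Set
Ray P q v k = (j : ℕ) → j ≤ k → step q j v ∈P P

ray? : ∀ P q v k → Dec (Ray P q v k)
ray? P q v k = Dec.map′ fromFin toFin (Fin.all? (λ (j : Fin _) → step q (toℕ j) v ∈? P))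
  where
  fromFin : (∀ (j : Fin _) → step q (toℕ j) v ∈P P) → Ray P q v k
  fromFin ray j j≤k = subst (λ i → step q i v ∈P P) (toℕ-fromℕ< (s≤s j≤k)) (ray (fromℕ< (s≤s j≤k)))
  toFin : Ray P q v k → ∀ (j : Fin _) → step q (toℕ j) v ∈P P
  toFin ray j = ray (toℕ j) (s≤s⁻¹ (toℕ<n j))

‖_‖ : Tile → ℕ
‖ a , b ‖ = ∣ a ∣ ⊔ ∣ b ∣

distance : Tile → Tile → ℕ
distance (x , y) (x′ , y′) = ‖ x′ ℤ.- x , y′ ℤ.- y ‖

unit-directions : All (λ v → ‖ v ‖ ≡ 1) directions
unit-directions = refl ∷ refl ∷ refl ∷ refl ∷ refl ∷ refl ∷ refl ∷ refl ∷ []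

∣x+kz-x∣≡k*∣z∣ : ∀ x k z → ∣ x ℤ.+ + k ℤ.* z ℤ.- x ∣ ≡ k * ∣ z ∣
∣x+kz-x∣≡k*∣z∣ x k z = trans (cong ∣_∣ (xyx⁻¹≈y x (+ k ℤ.* z))) (abs-* (+ k) z)

distance-step : ∀ q k v → ‖ v ‖ ≡ 1 → distance q (step q k v) ≡ k
distance-step (x , y) k (a , b) ‖v‖≡1 = begin
  ∣ x ℤ.+ + k ℤ.* a ℤ.- x ∣ ⊔ ∣ y ℤ.+ + k ℤ.* b ℤ.- y ∣
    ≡⟨ cong₂ _⊔_ (∣x+kz-x∣≡k*∣z∣ x k a) (∣x+kz-x∣≡k*∣z∣ y k b) ⟩
  k * ∣ a ∣ ⊔ k * ∣ b ∣
    ≡⟨ *-distribˡ-⊔ k ∣ a ∣ ∣ b ∣ ⟨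
  k * ‖ a , b ‖
    ≡⟨ cong (k *_) ‖v‖≡1 ⟩
  k * 1
    ≡⟨ *-identityʳ k ⟩
  k ∎
  where open ≡-Reasoning

RayHit : Polyomino → Tile → Tile → Tile → Set
RayHit P q t v = 1 ≤ d × t ≡ step q d v × Ray P q v d
  where d = distance q t

guards⇔ : ∀ P q t → Guards P q t ⇔ (t ≡ q ⊎ Any (RayHit P q t) directions)
guards⇔ P q t = mk⇔ to from
  where
  to : Guards P q t → t ≡ q ⊎ Any (RayHit P q t) directions
  to (inj₁ t≡q) = inj₁ t≡q
  to (inj₂ (v , v∈ , k , 1≤k , refl , ray)) =
    inj₂ (lose v∈ (subst (λ d → 1 ≤ d × t ≡ step q d v × Ray P q v d)
                         (sym (distance-step q k v (All.lookup unit-directions v∈)))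
                         (1≤k , refl , ray)))
  from : t ≡ q ⊎ Any (RayHit P q t) directions → Guards P q t
  from (inj₁ t≡q) = inj₁ t≡q
  from (inj₂ hit) with v , v∈ , 1≤d , t≡ , ray ← find hit = inj₂ (v , v∈ , _ , 1≤d , t≡ , ray)

guards? : ∀ P q t → Dec (Guards P q t)
guards? P q t = Dec.map (⇔.sym (guards⇔ P q t)) (t ≟ᵗ q ⊎-dec any? rayHit? directions)
  where
  rayHit? : ∀ v → Dec (RayHit P q t v)
  rayHit? v = (1 ≤? distance q t) ×-dec (t ≟ᵗ step q (distance q t) v) ×-dec ray? P q v (distance q t)

guardsAll? : ∀ P Qs → Dec (GuardsAll P Qs)
guardsAll? P Qs = all? (λ t → Dec.map′ find (λ (q , q∈ , g) → lose q∈ g) (any? (λ q → guards? P q t) Qs)) P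

module _ {A : Set} where

  ∈⇒↭∷ : ∀ {x : A} {xs} → x ∈ xs → ∃[ ys ] xs ↭ x ∷ ys
  ∈⇒↭∷ x∈xs with ys , zs , refl ← ∈-∃++ x∈xs = ys ++ zs , shift _ ys zs

  ↭-prefix : {Req Qs : List A} → Unique Req → All (_∈ Qs) Req → ∃[ rest ] Qs ↭ Req ++ rest
  ↭-prefix {[]} {Qs} [] [] = Qs , ↭-refl
  ↭-prefix {x ∷ Req} {Qs} (x∉Req ∷ uniq) (x∈Qs ∷ Req⊆Qs) with ys , Qs↭x∷ys ← ∈⇒↭∷ x∈Qs =
    let rest , ys↭ = ↭-prefix uniq (All.zipWith inYs (x∉Req , Req⊆Qs))
    in rest , ↭-trans Qs↭x∷ys (prep x ys↭)
    where
    inYs : ∀ {y} → x ≢ y × y ∈ Qs → y ∈ ys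
    inYs (x≢y , y∈Qs) with ∈-resp-↭ Qs↭x∷ys y∈Qs
    ... | here y≡x = contradiction (sym y≡x) x≢y
    ... | there y∈ys = y∈ys

GuardsAll-resp-↭ : ∀ P {Qs Rs} → Qs ↭ Rs → GuardsAll P Qs → GuardsAll P Rs
GuardsAll-resp-↭ P Qs↭Rs = All.map (λ (q , q∈Qs , guards) → q , ∈-resp-↭ Qs↭Rs q∈Qs , guards)

guardable⇒extension : ∀ {P Req} m → Unique Req → GuardableWith P (length Req + m) Req →
                      ∃[ rest ] length rest ≡ m × All (_∈P P) rest × GuardsAll P (Req ++ rest)
guardable⇒extension {P} {Req} m uniq (Qs , (_ , Qs⊆P) , len , Req⊆Qs , guarded)
  with rest , Qs↭ ← ↭-prefix uniq Req⊆Qs =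
  rest , +-cancelˡ-≡ (length Req) _ _ lengths , ++⁻ʳ Req (All-resp-↭ Qs↭ Qs⊆P) , GuardsAll-resp-↭ P Qs↭ guarded
  where
  open ≡-Reasoning
  lengths : length Req + length rest ≡ length Req + m
  lengths = begin
    length Req + length rest ≡⟨ length-++ Req ⟨
    length (Req ++ rest)     ≡⟨ ↭-length Qs↭ ⟨
    length Qs                ≡⟨ len ⟩
    length Req + m           ∎

NoGuardingExtension₁ : Polyomino → List Tile → Set
NoGuardingExtension₁ P Req = All (λ q → ¬ GuardsAll P (Req ++ q ∷ [])) P

NoGuardingExtension₂ : Polyomino → List Tile → Set
NoGuardingExtension₂ P Req = All (λ a → All (λ b → ¬ GuardsAll P (Req ++ a ∷ b ∷ [])) P) P

noGuardingExtension₁? : ∀ P Req → Dec (NoGuardingExtension₁ P Req)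
noGuardingExtension₁? P Req = all? (λ q → ¬? (guardsAll? P (Req ++ q ∷ []))) P

noGuardingExtension₂? : ∀ P Req → Dec (NoGuardingExtension₂ P Req)
noGuardingExtension₂? P Req = all? (λ a → all? (λ b → ¬? (guardsAll? P (Req ++ a ∷ b ∷ []))) P) P

¬guardable-one-more : ∀ {P Req} → Unique Req → NoGuardingExtension₁ P Req → ¬ GuardableWith P (length Req + 1) Req
¬guardable-one-more uniq hopeless guardable
  with q ∷ [] , refl , q∈P ∷ [] , guarded ← guardable⇒extension 1 uniq guardable =
  All.lookup hopeless q∈P guarded

¬guardable-two-more : ∀ {P Req} → Unique Req → NoGuardingExtension₂ P Req → ¬ GuardableWith P (length Req + 2) Req
¬guardable-two-more uniq hopeless guardable
  with a ∷ b ∷ [] , refl , a∈P ∷ b∈P ∷ [] , guarded ← guardable⇒extension 2 uniq guardable =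
  All.lookup (All.lookup hopeless a∈P) b∈P guarded

queenSet? : ∀ P Qs → Dec (IsQueenSet P Qs)
queenSet? P Qs = unique? Qs ×-dec all? (_∈? P) Qs

guardableWith? : ∀ P Req Qs → Dec (IsQueenSet P Qs × All (_∈ Qs) Req × GuardsAll P Qs)
guardableWith? P Req Qs = queenSet? P Qs ×-dec all? (_∈? Qs) Req ×-dec guardsAll? P Qs

guardable-by : ∀ P Req Qs → True (guardableWith? P Req Qs) → GuardableWith P (length Qs) Req
guardable-by P Req Qs valid with queens , Req⊆Qs , guarded ← toWitness valid =
  Qs , queens , refl , Req⊆Qs , guarded

lemma11 : ¬ GuardableWith W 2 []
          × GuardableWith W 3 (A ∷ [])
          × GuardableWith W 3 (B ∷ C ∷ [])
          × ¬ GuardableWith W 3 (A ∷ B ∷ [])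
          × ¬ GuardableWith W 3 (A ∷ C ∷ [])
lemma11 =
  ¬guardable-two-more [] (from-yes (noGuardingExtension₂? W [])) ,
  guardable-by W (A ∷ []) (A ∷ pt 3 1 ∷ pt 3 3 ∷ []) _ ,
  guardable-by W (B ∷ C ∷ []) (B ∷ C ∷ pt 2 2 ∷ []) _ ,
  ¬guardable-one-more (from-yes (unique? (A ∷ B ∷ []))) (from-yes (noGuardingExtension₁? W (A ∷ B ∷ []))) ,
  ¬guardable-one-more (from-yes (unique? (A ∷ C ∷ []))) (from-yes (noGuardingExtension₁? W (A ∷ C ∷ [])))
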